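{- Let $G$ be a connected graph with $m$ edges and let $H_1,\dots,H_m$ be arbitrary graphs. Then $$\alpha(G\diamond(H_1,\dots,H_m))=\sum_{i=1}^m\alpha(H_i).$$
   Context: For a simple graph $G$ with edge set $\{e_1,\dots,e_m\}$ and simple graphs $H_1,\dots,H_m$, the generalized edge corona product $G\diamond(H_1,\dots,H_m)$ is the graph obtained by taking one (vertex-disjoint) copy of each of $G,H_1,\dots,H_m$ and joining both end vertices of the $i$-th edge $e_i$ of $G$ to every vertex of $H_i$. $\alpha$ denotes the independence number (maximum size of a set of pairwise non-adjacent vertices). -}

module Defs where

open import Data.Nat using (ℕ; _≤_; _+_)
open import Data.Fin using (Fin)
open import Data.Product using (Σ; _×_; _,_; proj₁; proj₂)
open import Data.Sum using (_⊎_; inj₁; inj₂)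
open import Relation.Nullary using (¬_)
open import Relation.Binary.PropositionalEquality using (_≡_; _≢_)
open import Function.Definitions using (Injective)

record SimpleGraph (n : ℕ) : Set₁ where
  field
    Adj    : Fin n → Fin n → Set
    sym    : ∀ {u v} → Adj u v → Adj v u
    irrefl : ∀ {u} → ¬ Adj u u
open SimpleGraph public

record EdgeGraph (n m : ℕ) : Set where
  field
    end₁ : Fin m → Fin n
    end₂ : Fin m → Fin n
    loopless : ∀ i → end₁ i ≢ end₂ i
    noMulti  : ∀ i j →
      ((end₁ i ≡ end₁ j × end₂ i ≡ end₂ j) ⊎ (end₁ i ≡ end₂ j × end₂ i ≡ end₁ j)) →
      i ≡ j
open EdgeGraph public

IsEnd : ∀ {n m} → EdgeGraph n m → Fin n → Fin m → Set
IsEnd G u i = (u ≡ end₁ G i) ⊎ (u ≡ end₂ G i)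

EAdj : ∀ {n m} → EdgeGraph n m → Fin n → Fin n → Set
EAdj {m = m} G u v =
  Σ (Fin m) λ i → (u ≡ end₁ G i × v ≡ end₂ G i) ⊎ (u ≡ end₂ G i × v ≡ end₁ G i)

data Reach {n m} (G : EdgeGraph n m) : Fin n → Fin n → Set where
  here : ∀ {u} → Reach G u u
  step : ∀ {u v w} → EAdj G u v → Reach G v w → Reach G u w

Connected : ∀ {n m} → EdgeGraph n m → Set
Connected {n} G = ∀ (u v : Fin n) → Reach G u v

CoronaV : (n m : ℕ) (h : Fin m → ℕ) → Set
CoronaV n m h = Fin n ⊎ Σ (Fin m) (λ i → Fin (h i))

data CoronaAdj {n m : ℕ} {h : Fin m → ℕ} (G : EdgeGraph n m)
       (H : (i : Fin m) → SimpleGraph (h i)) :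
       CoronaV n m h → CoronaV n m h → Set where
  base  : ∀ {u v} → EAdj G u v → CoronaAdj G H (inj₁ u) (inj₁ v)
  inner : ∀ {i x y} → Adj (H i) x y → CoronaAdj G H (inj₂ (i , x)) (inj₂ (i , y))
  up    : ∀ {u i x} → IsEnd G u i → CoronaAdj G H (inj₁ u) (inj₂ (i , x))
  down  : ∀ {u i x} → IsEnd G u i → CoronaAdj G H (inj₂ (i , x)) (inj₁ u)

IsIndependent : {V : Set} (Adj : V → V → Set) {k : ℕ} → (Fin k → V) → Set
IsIndependent Adj {k} f = Injective _≡_ _≡_ f × (∀ (a b : Fin k) → ¬ Adj (f a) (f b))

IndependenceNumber : {V : Set} (Adj : V → V → Set) → ℕ → Set
IndependenceNumber {V} Adj k =
  Σ (Fin k → V) (IsIndependent Adj) ×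
  (∀ (k' : ℕ) (f : Fin k' → V) → IsIndependent Adj f → k' ≤ k)

∑ : (m : ℕ) → (Fin m → ℕ) → ℕ
∑ ℕ.zero    a = 0
∑ (ℕ.suc m) a = a Fin.zero + ∑ m (λ i → a (Fin.suc i))

module Submission where

-- Lower bound: the union of maximum independent sets of the copies H₁,…,Hₘ
-- is independent in the corona (vertices of distinct copies are never
-- adjacent), and it has ∑ α(Hᵢ) elements.
--
-- Upper bound: since G is connected with at least one edge, every vertex u
-- of G is an end of some edge, which we fix and call the class of u; a
-- vertex of the copy Hᵢ gets class i.  In an independent set S, the members
-- of class i are either a single vertex of G (any other member of class i
-- is a vertex of Hᵢ or the other end of edge i, both adjacent to it) or
-- form an independent set of Hᵢ; in both cases there are at most α(Hᵢ) of
-- them, as α(Hᵢ) ≥ 1.  Summing over the classes gives |S| ≤ ∑ α(Hᵢ).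

open import Defs hiding (sym)
open import Data.Nat using (ℕ; zero; suc; _+_; _≤_; z≤n)
open import Data.Nat.Properties using (+-suc; +-mono-≤; ≤-trans)
open import Data.Fin using (Fin; zero; suc; splitAt; join; lift; punchOut; fromℕ<; _≟_)
open import Data.Fin.Properties
  using (any?; join-splitAt; lift-injective; suc-injective; punchIn-punchOut; injective⇒≤)
open import Data.Product using (Σ; _,_; proj₁; proj₂)
open import Data.Product.Properties using (Σ-≡,≡←≡)
open import Data.Sum using (inj₁; inj₂)
open import Data.Sum.Properties using (inj₂-injective)
open import Data.Empty using (⊥-elim)
open import Function using (_∘_)
open import Relation.Nullary using (¬_; Dec; yes; no)
open import Relation.Binary.PropositionalEquality
  using (_≡_; refl; sym; trans; cong; subst; subst₂; module ≡-Reasoning)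
open import Function.Definitions using (Injective)

record Enumeration (k : ℕ) (P : Fin k → Set) : Set where
  field
    size      : ℕ
    enum      : Fin size → Fin k
    injective : Injective _≡_ _≡_ enum
    sound     : ∀ x → P (enum x)
open Enumeration

pushforward : ∀ {t k} {Q : Fin t → Set} {P : Fin k → Set}
  (e : Fin t → Fin k) → Injective _≡_ _≡_ e → (∀ x → Q x → P (e x)) →
  Enumeration t Q → Enumeration k P
pushforward e e-inj Q⇒P E =
  record { size = size E ; enum = e ∘ enum E
         ; injective = injective E ∘ e-inj ; sound = λ x → Q⇒P _ (sound E x) }

shift : ∀ {k} {P : Fin (suc k) → Set} → Enumeration k (P ∘ suc) → Enumeration (suc k) P
shift E = record { size = size E ; enum = suc ∘ enum E
                 ; injective = injective E ∘ suc-injective ; sound = sound E }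

cons : ∀ {k} {P : Fin (suc k) → Set} → P zero → Enumeration k (P ∘ suc) → Enumeration (suc k) P
cons P0 E = record { size = suc (size E) ; enum = lift 1 (enum E)
                   ; injective = lift-injective (enum E) (injective E) 1
                   ; sound = λ { zero → P0 ; (suc x) → sound E x } }

record Partition (k : ℕ) (P : Fin k → Set) : Set where
  field
    inPart  : Enumeration k P
    outPart : Enumeration k (¬_ ∘ P)
    sizes   : size inPart + size outPart ≡ k
open Partition

partition : ∀ k (P : Fin k → Set) → (∀ x → Dec (P x)) → Partition k P
partition zero P P? = record
  { inPart  = record { size = 0 ; enum = λ () ; injective = λ { {()} } ; sound = λ () }
  ; outPart = record { size = 0 ; enum = λ () ; injective = λ { {()} } ; sound = λ () }
  ; sizes   = refl }
partition (suc k) P P? with partition k (P ∘ suc) (P? ∘ suc) | P? zero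
... | Π | yes P0 = record
  { inPart = cons P0 (inPart Π) ; outPart = shift (outPart Π) ; sizes = cong suc (sizes Π) }
... | Π | no ¬P0 = record
  { inPart = shift (inPart Π) ; outPart = cons ¬P0 (outPart Π)
  ; sizes  = trans (+-suc (size (inPart Π)) _) (cong suc (sizes Π)) }

FibresBoundedBy : ∀ {k m} → (Fin k → Fin m) → (Fin m → ℕ) → Set
FibresBoundedBy {k} {m} c b = ∀ i (E : Enumeration k (λ x → c x ≡ i)) → size E ≤ b i

-- If the fibres of c : Fin k → Fin m are bounded by b, then k ≤ ∑ b.
-- Split off the fibre over zero; the rest is classified into Fin m.
fibreCount : ∀ m {k} (c : Fin k → Fin m) (b : Fin m → ℕ) → FibresBoundedBy c b → k ≤ ∑ m b
fibreCount zero {zero} c b bounded = z≤n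
fibreCount zero {suc k} c b bounded with c zero
... | ()
fibreCount (suc m) {k} c b bounded =
  subst (_≤ ∑ (suc m) b) (sizes Π)
    (+-mono-≤ (bounded zero (inPart Π))
              (fibreCount m c′ (b ∘ suc) restBounded))
  where
  Π = partition k (λ x → c x ≡ zero) (λ x → c x ≟ zero)
  rest = outPart Π

  c′ : Fin (size rest) → Fin m
  c′ x = punchOut (sound rest x ∘ sym)

  c′-correct : ∀ x → suc (c′ x) ≡ c (enum rest x)
  c′-correct x = punchIn-punchOut (sound rest x ∘ sym)

  restBounded : FibresBoundedBy c′ (b ∘ suc)
  restBounded i E = bounded (suc i) (pushforward (enum rest) (injective rest)
                      (λ x c′x≡i → trans (sym (c′-correct x)) (cong suc c′x≡i)) E)

injective-constant≤1 : ∀ {A : Set} {s} (g : Fin s → A) (w : A) →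
  Injective _≡_ _≡_ g → (∀ t → g t ≡ w) → s ≤ 1
injective-constant≤1 g w g-inj g≡w =
  injective⇒≤ {f = λ _ → zero} (λ {x} {y} _ → g-inj (trans (g≡w x) (sym (g≡w y))))

flatten : ∀ m (a : Fin m → ℕ) → Σ (Fin m) (Fin ∘ a) → Fin (∑ m a)
flatten (suc m) a (zero  , y) = join (a zero) _ (inj₁ y)
flatten (suc m) a (suc i , y) = join (a zero) _ (inj₂ (flatten m (a ∘ suc) (i , y)))

unflatten : ∀ m (a : Fin m → ℕ) → Fin (∑ m a) → Σ (Fin m) (Fin ∘ a)
unflatten (suc m) a x with splitAt (a zero) x
... | inj₁ y = zero , y
... | inj₂ z with unflatten m (a ∘ suc) z
...   | i , y = suc i , y

splitAt⇒join : ∀ k l {x : Fin (k + l)} {s} → splitAt k x ≡ s → join k l s ≡ x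
splitAt⇒join k l {x} refl = join-splitAt k l x

flatten-unflatten : ∀ m a x → flatten m a (unflatten m a x) ≡ x
flatten-unflatten (suc m) a x with splitAt (a zero) x in split
... | inj₁ y = splitAt⇒join (a zero) _ split
... | inj₂ z with unflatten m (a ∘ suc) z in unflattenRest
...   | i , y = begin
  join (a zero) _ (inj₂ (flatten m (a ∘ suc) (i , y)))
    ≡⟨ cong (λ w → join (a zero) _ (inj₂ (flatten m (a ∘ suc) w))) (sym unflattenRest) ⟩
  join (a zero) _ (inj₂ (flatten m (a ∘ suc) (unflatten m (a ∘ suc) z)))
    ≡⟨ cong (λ w → join (a zero) _ (inj₂ w)) (flatten-unflatten m (a ∘ suc) z) ⟩
  join (a zero) _ (inj₂ z)
    ≡⟨ splitAt⇒join (a zero) _ split ⟩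
  x ∎
  where open ≡-Reasoning

unflatten-injective : ∀ m a → Injective _≡_ _≡_ (unflatten m a)
unflatten-injective m a {x} {y} eq =
  trans (sym (flatten-unflatten m a x))
        (trans (cong (flatten m a) eq) (flatten-unflatten m a y))

independenceNumber≥1 : ∀ {V : Set} {Adj : V → V → Set} {k} →
  (∀ {v} → ¬ Adj v v) → V → IndependenceNumber Adj k → 1 ≤ k
independenceNumber≥1 irr v (_ , maximal) =
  maximal 1 (λ _ → v) ((λ { {zero} {zero} _ → refl }) , (λ _ _ → irr))

module Corona {n m : ℕ} (G : EdgeGraph n m) {h : Fin m → ℕ}
              (H : (i : Fin m) → SimpleGraph (h i)) where

  V : Set
  V = CoronaV n m h

  Independent : ∀ {k} → (Fin k → V) → Set
  Independent = IsIndependent (CoronaAdj G H)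

  module _ (a : Fin m → ℕ) (f : ∀ i → Fin (a i) → Fin (h i))
           (f-independent : ∀ i → IsIndependent (Adj (H i)) (f i)) where

    copyVertex : Σ (Fin m) (Fin ∘ a) → V
    copyVertex (i , y) = inj₂ (i , f i y)

    copyVertex-injective : Injective _≡_ _≡_ copyVertex
    copyVertex-injective {i , y} {_ , y′} eq with Σ-≡,≡←≡ (inj₂-injective eq)
    ... | refl , fy≡fy′ = cong (i ,_) (proj₁ (f-independent i) fy≡fy′)

    copyVertex-independent : ∀ p q → ¬ CoronaAdj G H (copyVertex p) (copyVertex q)
    copyVertex-independent (i , y) (_ , y′) (inner adj) = proj₂ (f-independent i) y y′ adj

    unionOfCopies : Fin (∑ m a) → V
    unionOfCopies = copyVertex ∘ unflatten m a

    unionOfCopies-independent : Independent unionOfCopies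
    unionOfCopies-independent =
      unflatten-injective m a ∘ copyVertex-injective ,
      λ x y → copyVertex-independent (unflatten m a x) (unflatten m a y)

  sameEdgeEnds : ∀ {i u u′} → IsEnd G u i → IsEnd G u′ i → ¬ EAdj G u u′ → u′ ≡ u
  sameEdgeEnds (inj₁ p) (inj₁ q) _ = trans q (sym p)
  sameEdgeEnds (inj₁ p) (inj₂ q) ¬adj = ⊥-elim (¬adj (_ , inj₁ (p , q)))
  sameEdgeEnds (inj₂ p) (inj₁ q) ¬adj = ⊥-elim (¬adj (_ , inj₂ (p , q)))
  sameEdgeEnds (inj₂ p) (inj₂ q) _ = trans q (sym p)

  module _ (incident : (u : Fin n) → Σ (Fin m) (IsEnd G u)) where

    class : V → Fin m
    class (inj₁ u)       = proj₁ (incident u)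
    class (inj₂ (i , _)) = i

    BaseVertex : V → Set
    BaseVertex v = Σ (Fin n) (λ u → v ≡ inj₁ u)

    baseVertex? : ∀ v → Dec (BaseVertex v)
    baseVertex? (inj₁ u) = yes (u , refl)
    baseVertex? (inj₂ _) = no λ { (_ , ()) }

    classOfBase : ∀ {i u v} → class (inj₁ u) ≡ i → class v ≡ i →
                  ¬ CoronaAdj G H (inj₁ u) v → v ≡ inj₁ u
    classOfBase {u = u} {inj₁ u′} refl u′∈i ¬adj =
      cong inj₁ (sameEdgeEnds (proj₂ (incident u))
                   (subst (IsEnd G u′) u′∈i (proj₂ (incident u′))) (¬adj ∘ base))
    classOfBase {u = u} {inj₂ _} refl refl ¬adj = ⊥-elim (¬adj (up (proj₂ (incident u))))

    copyPart : ∀ i v → ¬ BaseVertex v → class v ≡ i → Σ (Fin (h i)) (λ x → inj₂ (i , x) ≡ v)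
    copyPart i (inj₁ u) notBase _ = ⊥-elim (notBase (u , refl))
    copyPart i (inj₂ (_ , x)) _ refl = x , refl

    module _ (a : Fin m → ℕ) (a≥1 : ∀ i → 1 ≤ a i)
             (αbound : ∀ i k (g : Fin k → Fin (h i)) → IsIndependent (Adj (H i)) g → k ≤ a i)
             where

      classBound : ∀ i {s} (g : Fin s → V) → Independent g → (∀ t → class (g t) ≡ i) → s ≤ a i
      classBound i {s} g (g-inj , g-ind) g∈i with any? (baseVertex? ∘ g)
      ... | yes (t₀ , u , gt₀≡u) =
        ≤-trans (injective-constant≤1 g (inj₁ u) g-inj allEqual) (a≥1 i)
        where
        allEqual : ∀ t → g t ≡ inj₁ u
        allEqual t = classOfBase (subst (λ v → class v ≡ i) gt₀≡u (g∈i t₀)) (g∈i t)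
                       (subst (λ v → ¬ CoronaAdj G H v (g t)) gt₀≡u (g-ind t₀ t))
      ... | no noBase = αbound i _ g′ (g′-injective , g′-independent)
        where
        inCopy : ∀ t → Σ (Fin (h i)) (λ x → inj₂ (i , x) ≡ g t)
        inCopy t = copyPart i (g t) (λ b → noBase (t , b)) (g∈i t)

        g′ : Fin s → Fin (h i)
        g′ = proj₁ ∘ inCopy

        g′-injective : Injective _≡_ _≡_ g′
        g′-injective {x} {y} eq =
          g-inj (trans (sym (proj₂ (inCopy x)))
                       (trans (cong (λ z → inj₂ (i , z)) eq) (proj₂ (inCopy y))))

        g′-independent : ∀ x y → ¬ Adj (H i) (g′ x) (g′ y)
        g′-independent x y adj =
          g-ind x y (subst₂ (CoronaAdj G H) (proj₂ (inCopy x)) (proj₂ (inCopy y)) (inner adj))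

      upperBound : ∀ k (f : Fin k → V) → Independent f → k ≤ ∑ m a
      upperBound k f (f-inj , f-ind) =
        fibreCount m (class ∘ f) a λ i E →
          classBound i (f ∘ enum E)
            (injective E ∘ f-inj , λ x y → f-ind (enum E x) (enum E y)) (sound E)

-- In a connected graph with an edge e₀, every vertex is an end of some edge:
-- a walk from it to an end of e₀ is either empty or starts with an edge.
connected⇒incident : ∀ {n m} (G : EdgeGraph n m) → Connected G → Fin m →
                     (u : Fin n) → Σ (Fin m) (IsEnd G u)
connected⇒incident {m = m} G conn e₀ u = walkStart (conn u (end₁ G e₀))
  where
  walkStart : ∀ {v} → Reach G v (end₁ G e₀) → Σ (Fin m) (IsEnd G v)
  walkStart here                            = e₀ , inj₁ refl
  walkStart (step (i , inj₁ (v≡end , _)) _) = i , inj₁ v≡end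
  walkStart (step (i , inj₂ (v≡end , _)) _) = i , inj₂ v≡end

mainTheorem14 :
    (n m : ℕ) (G : EdgeGraph n m) → Connected G → 1 ≤ m →
    (h : Fin m → ℕ) → (∀ i → 1 ≤ h i) →
    (H : (i : Fin m) → SimpleGraph (h i)) →
    (a : Fin m → ℕ) → (∀ i → IndependenceNumber (Adj (H i)) (a i)) →
    IndependenceNumber (CoronaAdj G H) (∑ m a)
mainTheorem14 n m G conn m≥1 h h≥1 H a α = lowerBound , upperBound incident a a≥1 (proj₂ ∘ α)
  where
  open Corona G H

  maxSet : ∀ i → Fin (a i) → Fin (h i)
  maxSet i = proj₁ (proj₁ (α i))

  lowerBound : Σ (Fin (∑ m a) → V) Independent
  lowerBound = unionOfCopies a maxSet (proj₂ ∘ proj₁ ∘ α)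
             , unionOfCopies-independent a maxSet (proj₂ ∘ proj₁ ∘ α)

  a≥1 : ∀ i → 1 ≤ a i
  a≥1 i = independenceNumber≥1 {Adj = Adj (H i)} (irrefl (H i)) (fromℕ< (h≥1 i)) (α i)

  incident : (u : Fin n) → Σ (Fin m) (IsEnd G u)
  incident = connected⇒incident G conn (fromℕ< m≥1)
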